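{- For every field $\mathbb F$, the graph parameter $\operatorname{vdcc}$, as a function on simple graphs, is not expressible as a graph homomorphism function over $\mathbb F$; that is, there is no $\mathbb F$-weighted graph $H$ such that $\operatorname{vdcc}(G)=\hom(G,H)$ for every simple graph $G$.
   Context: For a simple graph $G$, $\operatorname{vdcc}(G)=m\cdot1\in\mathbb F$ where $m$ is the number of edge subsets $E'\subseteq E(G)$ forming a set of vertex-disjoint cycles covering all vertices of $G$ (equivalently, every vertex of $G$ has degree exactly $2$ in $(V(G),E')$); the empty graph has $m=1$. An $\mathbb F$-weighted graph $H$ is given by $q=|V(H)|\ge0$, vertex weights $\alpha_1,\dots,\alpha_q\in\mathbb F\setminus\{0\}$ and a symmetric matrix $B=(\beta_{ij})\in\mathbb F^{q\times q}$; $\hom(G,H)=\sum_{\phi:V(G)\to[q]}\prod_{u\in V(G)}\alpha_{\phi(u)}\prod_{uv\in E(G)}\beta_{\phi(u)\phi(v)}$ (empty products equal $1$). -}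

module Defs where

open import Level using (_⊔_)
open import Algebra.Bundles using (CommutativeRing)
open import Data.Nat as ℕ using (ℕ; zero; suc)
open import Data.Bool using (Bool; true; false; if_then_else_; _∧_; _∨_; T)
open import Data.Fin using (Fin; toℕ; _≟_)
open import Data.List using (List; []; _∷_; [_]; _++_; map; concatMap; foldr; allFin; length)
open import Data.Product using (_×_; _,_; Σ)
open import Relation.Nullary using (¬_; does)
open import Relation.Binary.PropositionalEquality using (_≡_)

record Field (c ℓ : Level.Level) : Set (Level.suc (c ⊔ ℓ)) where
  field
    commutativeRing : CommutativeRing c ℓ
  open CommutativeRing commutativeRing public
  field
    1≉0     : ¬ (1# ≈ 0#)
    inverse : ∀ x → ¬ (x ≈ 0#) → Σ Carrier (λ y → (x * y) ≈ 1#)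

record SimpleGraph : Set where
  field
    n      : ℕ
    adj    : Fin n → Fin n → Bool
    sym    : ∀ i j → adj i j ≡ adj j i
    irrefl : ∀ i → adj i i ≡ false

open SimpleGraph public

edges : (G : SimpleGraph) → List (Fin (n G) × Fin (n G))
edges G = concatMap (λ i → concatMap (λ j →
            if (toℕ i ℕ.<ᵇ toℕ j) ∧ adj G i j then [ (i , j) ] else [])
            (allFin (n G))) (allFin (n G))

-- All sublists (= all subsets, as the edge list has no repetitions).
sublists : ∀ {a} {A : Set a} → List A → List (List A)
sublists []       = [] ∷ []
sublists (x ∷ xs) = map (x ∷_) (sublists xs) ++ sublists xs

countᵇ : ∀ {a} {A : Set a} → (A → Bool) → List A → ℕ
countᵇ p []       = zero
countᵇ p (x ∷ xs) = if p x then suc (countᵇ p xs) else countᵇ p xs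

allᵇ : ∀ {a} {A : Set a} → (A → Bool) → List A → Bool
allᵇ p []       = true
allᵇ p (x ∷ xs) = p x ∧ allᵇ p xs

degree : ∀ {k} → Fin k → List (Fin k × Fin k) → ℕ
degree v = countᵇ (λ { (i , j) → does (v ≟ i) ∨ does (v ≟ j) })

isVDCC : (G : SimpleGraph) → List (Fin (n G) × Fin (n G)) → Bool
isVDCC G E' = allᵇ (λ v → degree v E' ℕ.≡ᵇ 2) (allFin (n G))

-- m = number of edge subsets forming vertex-disjoint cycles covering all vertices
vdccCount : SimpleGraph → ℕ
vdccCount G = countᵇ (isVDCC G) (sublists (edges G))

module _ {c ℓ} (F : Field c ℓ) where
  open Field F

  natF : ℕ → Carrier
  natF zero    = 0#
  natF (suc m) = 1# + natF m

  vdcc : SimpleGraph → Carrier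
  vdcc G = natF (vdccCount G)

  sumFin : ∀ k → (Fin k → Carrier) → Carrier
  sumFin zero    f = 0#
  sumFin (suc k) f = f Fin.zero + sumFin k (λ i → f (Fin.suc i))

  prodFin : ∀ k → (Fin k → Carrier) → Carrier
  prodFin zero    f = 1#
  prodFin (suc k) f = f Fin.zero * prodFin k (λ i → f (Fin.suc i))

  sumMaps : ∀ k q → ((Fin k → Fin q) → Carrier) → Carrier
  sumMaps zero    q f = f (λ ())
  sumMaps (suc k) q f = sumFin q (λ a → sumMaps k q (λ φ → f (λ { Fin.zero → a ; (Fin.suc i) → φ i })))

  record WeightedGraph : Set (c ⊔ ℓ) where
    field
      q       : ℕ
      α       : Fin q → Carrier
      β       : Fin q → Fin q → Carrier
      α≉0     : ∀ i → ¬ (α i ≈ 0#)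
      β-sym   : ∀ i j → β i j ≈ β j i

  hom : SimpleGraph → WeightedGraph → Carrier
  hom G H = sumMaps (n G) q (λ φ →
              prodFin (n G) (λ u → α (φ u)) *
              foldr (λ { (u , v) acc → β (φ u) (φ v) * acc }) 1# (edges G))
    where open WeightedGraph H

module Submission where

-- The test graphs are the windmills W k: k triangles sharing a hub.  W 1 is a triangle,
-- with exactly one cycle cover, so vdcc (W 1) = 1.  For k ≥ 2, in a spanning subgraph in
-- which every other vertex has degree 2 each triangle must be taken whole, so the hub has
-- degree 2k ≠ 2 and vdcc (W k) = 0.
--
-- For a weighted graph H, peeling one triangle at a time gives
--   hom (W k, H) = Σₐ αₐ tₐᵏ,   tₐ = Σ_{b,c} α_b α_c β_bc β_ba β_ca,
-- a power sum.  Over a field, power sums Σᵢ aᵢ tᵢᵏ that vanish for every k ≥ 2 cannot have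
-- a nonzero first term (proved by deflating one node at a time); equality in F is not
-- decidable, so this is stated with a double negation.  Hence hom (W k, H) = vdcc (W k)
-- for all k would force 1 = 0.

open import Defs hiding (sym)
open import Data.Product using (Σ; _,_)
open import Relation.Nullary using (¬_)

module Sublists where

  open import Data.Bool using (Bool; true; false)
  open import Data.Bool.Properties using (T-≡)
  open import Data.List using (List; []; _∷_; _++_; map; allFin)
  open import Data.List.Membership.Propositional using (_∈_)
  open import Data.List.Membership.Propositional.Properties using (∈-allFin)
  open import Data.List.Relation.Binary.Sublist.Propositional using (_⊆_; []; _∷_; _∷ʳ_)
  open import Data.List.Relation.Unary.Any using (here; there)
  open import Data.Nat using (suc; _+_; _≡ᵇ_)
  open import Data.Nat.Properties using (≡ᵇ⇒≡)
  open import Data.Product using (_×_)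
  open import Function using (_∘_)
  open import Function.Bundles using (Equivalence)
  open import Relation.Binary.PropositionalEquality
    using (_≡_; refl; cong; cong₂; module ≡-Reasoning)

  countᵇ-++ : ∀ {a} {A : Set a} (p : A → Bool) xs ys →
              countᵇ p (xs ++ ys) ≡ countᵇ p xs + countᵇ p ys
  countᵇ-++ p []       ys = refl
  countᵇ-++ p (x ∷ xs) ys with p x
  ... | true  = cong suc (countᵇ-++ p xs ys)
  ... | false = countᵇ-++ p xs ys

  countᵇ-map : ∀ {a b} {A : Set a} {B : Set b} (p : B → Bool) (f : A → B) xs →
               countᵇ p (map f xs) ≡ countᵇ (p ∘ f) xs
  countᵇ-map p f []       = refl
  countᵇ-map p f (x ∷ xs) with p (f x)
  ... | true  = cong suc (countᵇ-map p f xs)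
  ... | false = countᵇ-map p f xs

  countᵇ-false : ∀ {a} {A : Set a} (xs : List A) → countᵇ (λ _ → false) xs ≡ 0
  countᵇ-false []       = refl
  countᵇ-false (_ ∷ xs) = countᵇ-false xs

  count-sublists-zero : ∀ {a} {A : Set a} (L : List A) (p : List A → Bool) →
    (∀ E → E ⊆ L → p E ≡ false) → countᵇ p (sublists L) ≡ 0
  count-sublists-zero []      p none with p [] | none [] []
  ... | false | _ = refl
  count-sublists-zero (x ∷ L) p none = begin
      countᵇ p (map (x ∷_) (sublists L) ++ sublists L)
    ≡⟨ countᵇ-++ p (map (x ∷_) (sublists L)) (sublists L) ⟩
      countᵇ p (map (x ∷_) (sublists L)) + countᵇ p (sublists L)
    ≡⟨ cong (_+ countᵇ p (sublists L)) (countᵇ-map p (x ∷_) (sublists L)) ⟩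
      countᵇ (p ∘ (x ∷_)) (sublists L) + countᵇ p (sublists L)
    ≡⟨ cong₂ _+_ (count-sublists-zero L (p ∘ (x ∷_)) (λ E s → none (x ∷ E) (refl ∷ s)))
                 (count-sublists-zero L p (λ E s → none E (x ∷ʳ s))) ⟩
      0
    ∎
    where open ≡-Reasoning

  ⊆-++-split : ∀ {a} {A : Set a} (xs : List A) {ys E} → E ⊆ xs ++ ys →
    Σ (List A) λ E₁ → Σ (List A) λ E₂ → E₁ ⊆ xs × E₂ ⊆ ys × E ≡ E₁ ++ E₂
  ⊆-++-split []       s = [] , _ , [] , s , refl
  ⊆-++-split (x ∷ xs) (x ∷ʳ s) with ⊆-++-split xs s
  ... | E₁ , E₂ , s₁ , s₂ , refl = E₁ , E₂ , x ∷ʳ s₁ , s₂ , refl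
  ⊆-++-split (x ∷ xs) (refl ∷ s) with ⊆-++-split xs s
  ... | E₁ , E₂ , s₁ , s₂ , refl = x ∷ E₁ , E₂ , refl ∷ s₁ , s₂ , refl

  ⊆-map-split : ∀ {a b} {A : Set a} {B : Set b} (f : A → B) {L E} → E ⊆ map f L →
    Σ (List A) λ E′ → E′ ⊆ L × E ≡ map f E′
  ⊆-map-split f {[]}    []         = [] , [] , refl
  ⊆-map-split f {x ∷ L} (_ ∷ʳ s)   with ⊆-map-split f s
  ... | E′ , s′ , refl = E′ , x ∷ʳ s′ , refl
  ⊆-map-split f {x ∷ L} (refl ∷ s) with ⊆-map-split f s
  ... | E′ , s′ , refl = x ∷ E′ , refl ∷ s′ , refl

  allᵇ-sound : ∀ {a} {A : Set a} (p : A → Bool) {x} xs → allᵇ p xs ≡ true → x ∈ xs → p x ≡ true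
  allᵇ-sound p (y ∷ xs) all (here refl) with p y | all
  ... | true | _ = refl
  allᵇ-sound p (y ∷ xs) all (there x∈) with p y | all
  ... | true | all′ = allᵇ-sound p xs all′ x∈

  isVDCC-sound : ∀ G E → isVDCC G E ≡ true → ∀ v → degree v E ≡ 2
  isVDCC-sound G E accepted v = ≡ᵇ⇒≡ _ _ (Equivalence.from T-≡
    (allᵇ-sound (λ u → degree u E ≡ᵇ 2) (allFin (n G)) accepted (∈-allFin v)))

module Windmills where

  open import Data.Bool using (Bool; true; false; if_then_else_; _∧_)
  open import Data.Bool.Properties using (if-float)
  open import Data.Empty using (⊥-elim)
  open import Data.Fin using (Fin; toℕ; _≟_)
  open import Data.List using (List; []; _∷_; [_]; _++_; map; concatMap; allFin; tabulate)
  open import Data.List.Properties using (concatMap-map; concatMap-cong; map-concatMap; map-tabulate)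
  open import Data.List.Relation.Binary.Sublist.Propositional using (_⊆_; []; _∷_; _∷ʳ_)
  open import Data.Nat using (ℕ; zero; suc; _+_; _*_; _<ᵇ_)
  open import Data.Nat.Properties using (*-suc; +-identityʳ; m+1+n≢0; suc-injective)
  open import Data.Product using (_×_)
  open import Function using (_∘_)
  open import Relation.Nullary.Decidable using (dec-true; dec-false)
  open import Relation.Binary.PropositionalEquality
    using (_≡_; _≢_; refl; sym; trans; cong; cong₂; subst; module ≡-Reasoning)
  open Sublists


  -- W 0 is the hub alone;
  -- W (k+1) puts two new "blade" vertices 0F, 1F in front of the vertices of W k
  -- (shifted by two, `old i`) and joins them to each other and to the hub.
  order : ℕ → ℕ
  order zero    = 1
  order (suc k) = suc (suc (order k))

  pattern 0F    = Fin.zero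
  pattern 1F    = Fin.suc Fin.zero
  pattern old i = Fin.suc (Fin.suc i)

  isHub : ∀ k → Fin (order k) → Bool
  isHub zero    0F      = true
  isHub (suc k) 0F      = false
  isHub (suc k) 1F      = false
  isHub (suc k) (old i) = isHub k i

  hub : ∀ k → Fin (order k)
  hub zero    = 0F
  hub (suc k) = old (hub k)

  isHub-hub : ∀ k → isHub k (hub k) ≡ true
  isHub-hub zero    = refl
  isHub-hub (suc k) = isHub-hub k

  non-hub : ∀ k {u} → isHub k u ≡ false → u ≢ hub k
  non-hub k {u} notHub refl with trans (sym (isHub-hub k)) notHub
  ... | ()

  windmillAdj : ∀ k → Fin (order k) → Fin (order k) → Bool
  windmillAdj zero    _       _       = false
  windmillAdj (suc k) 0F      0F      = false
  windmillAdj (suc k) 0F      1F      = true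
  windmillAdj (suc k) 0F      (old j) = isHub k j
  windmillAdj (suc k) 1F      0F      = true
  windmillAdj (suc k) 1F      1F      = false
  windmillAdj (suc k) 1F      (old j) = isHub k j
  windmillAdj (suc k) (old i) 0F      = isHub k i
  windmillAdj (suc k) (old i) 1F      = isHub k i
  windmillAdj (suc k) (old i) (old j) = windmillAdj k i j

  windmillAdj-sym : ∀ k i j → windmillAdj k i j ≡ windmillAdj k j i
  windmillAdj-sym zero    i       j       = refl
  windmillAdj-sym (suc k) 0F      0F      = refl
  windmillAdj-sym (suc k) 0F      1F      = refl
  windmillAdj-sym (suc k) 0F      (old j) = refl
  windmillAdj-sym (suc k) 1F      0F      = refl
  windmillAdj-sym (suc k) 1F      1F      = refl
  windmillAdj-sym (suc k) 1F      (old j) = refl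
  windmillAdj-sym (suc k) (old i) 0F      = refl
  windmillAdj-sym (suc k) (old i) 1F      = refl
  windmillAdj-sym (suc k) (old i) (old j) = windmillAdj-sym k i j

  windmillAdj-irrefl : ∀ k i → windmillAdj k i i ≡ false
  windmillAdj-irrefl zero    i       = refl
  windmillAdj-irrefl (suc k) 0F      = refl
  windmillAdj-irrefl (suc k) 1F      = refl
  windmillAdj-irrefl (suc k) (old i) = windmillAdj-irrefl k i

  W : ℕ → SimpleGraph
  W k = record { n = order k ; adj = windmillAdj k
               ; sym = windmillAdj-sym k ; irrefl = windmillAdj-irrefl k }

  Edge : ℕ → Set
  Edge m = Fin m × Fin m

  shift : ∀ {m} → Edge m → Edge (suc (suc m))
  shift (i , j) = old i , old j

  triangle : ∀ k → List (Edge (order (suc k)))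
  triangle k = (0F , 1F) ∷ (0F , old (hub k)) ∷ (1F , old (hub k)) ∷ []

  cell : (G : SimpleGraph) → Fin (n G) → Fin (n G) → List (Edge (n G))
  cell G i j = if (toℕ i <ᵇ toℕ j) ∧ adj G i j then [ (i , j) ] else []

  edgeRow : (G : SimpleGraph) → Fin (n G) → List (Edge (n G))
  edgeRow G i = concatMap (cell G i) (allFin (n G))

  concatMap-allFin² : ∀ {a} {A : Set a} {m} (f : Fin (suc (suc m)) → List A) →
    concatMap f (allFin (suc (suc m))) ≡ f 0F ++ f 1F ++ concatMap (f ∘ old) (allFin m)
  concatMap-allFin² {m = m} f = cong (λ rest → f 0F ++ f 1F ++ rest) (begin
      concatMap f (tabulate old)
    ≡⟨ cong (concatMap f) (sym (map-tabulate (λ i → i) old)) ⟩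
      concatMap f (map old (allFin m))
    ≡⟨ concatMap-map f old (allFin m) ⟩
      concatMap (f ∘ old) (allFin m)
    ∎)
    where open ≡-Reasoning

  select-hub : ∀ {a} {A : Set a} k (f : Fin (order k) → A) →
    concatMap (λ j → if isHub k j then [ f j ] else []) (allFin (order k)) ≡ [ f (hub k) ]
  select-hub zero    f = refl
  select-hub (suc k) f =
    trans (concatMap-allFin² (λ j → if isHub (suc k) j then [ f j ] else [])) (select-hub k (f ∘ old))

  edgeRow-old : ∀ k i → edgeRow (W (suc k)) (old i) ≡ map shift (edgeRow (W k) i)
  edgeRow-old k i = begin
      edgeRow (W (suc k)) (old i)
    ≡⟨ concatMap-allFin² (cell (W (suc k)) (old i)) ⟩
      concatMap (λ j → if (toℕ i <ᵇ toℕ j) ∧ windmillAdj k i j then [ shift (i , j) ] else [])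
                (allFin (order k))
    ≡⟨ concatMap-cong (λ j → if-float (map shift) ((toℕ i <ᵇ toℕ j) ∧ windmillAdj k i j))
                      (allFin (order k)) ⟨
      concatMap (map shift ∘ cell (W k) i) (allFin (order k))
    ≡⟨ map-concatMap shift (cell (W k) i) (allFin (order k)) ⟨
      map shift (edgeRow (W k) i)
    ∎
    where open ≡-Reasoning

  windmill-edges : ∀ k → edges (W (suc k)) ≡ triangle k ++ map shift (edges (W k))
  windmill-edges k = begin
      edges (W (suc k))
    ≡⟨ concatMap-allFin² (edgeRow (W (suc k))) ⟩
      edgeRow (W (suc k)) 0F ++ edgeRow (W (suc k)) 1F
        ++ concatMap (edgeRow (W (suc k)) ∘ old) (allFin (order k))
    ≡⟨ cong₂ _++_ (trans (concatMap-allFin² (cell (W (suc k)) 0F))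
                         (cong ((0F , 1F) ∷_) (select-hub k (λ j → 0F , old j))))
         (cong₂ _++_ (trans (concatMap-allFin² (cell (W (suc k)) 1F)) (select-hub k (λ j → 1F , old j)))
                     (concatMap-cong (edgeRow-old k) (allFin (order k)))) ⟩
      triangle k ++ concatMap (map shift ∘ edgeRow (W k)) (allFin (order k))
    ≡⟨ cong (triangle k ++_) (sym (map-concatMap shift (edgeRow (W k)) (allFin (order k)))) ⟩
      triangle k ++ map shift (edges (W k))
    ∎
    where open ≡-Reasoning

  degree-shift : ∀ {m} (v : Fin m) E → degree (old v) (map shift E) ≡ degree v E
  degree-shift v E = countᵇ-map _ shift E

  degree-0F-shift : ∀ {m} (E : List (Edge m)) → degree 0F (map shift E) ≡ 0
  degree-0F-shift E = trans (countᵇ-map _ shift E) (countᵇ-false E)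

  degree-1F-shift : ∀ {m} (E : List (Edge m)) → degree 1F (map shift E) ≡ 0
  degree-1F-shift E = trans (countᵇ-map _ shift E) (countᵇ-false E)

  degree-hub-attached : ∀ k E → degree (old (hub k)) (triangle k ++ map shift E) ≡ 2 + degree (hub k) E
  degree-hub-attached k E rewrite dec-true (hub k ≟ hub k) refl = cong (2 +_) (degree-shift (hub k) E)

  degree-other-attached : ∀ k {u} E → isHub k u ≡ false →
    degree (old u) (triangle k ++ map shift E) ≡ degree u E
  degree-other-attached k {u} E notHub rewrite dec-false (u ≟ hub k) (non-hub k notHub) = degree-shift u E

  triangle-forced : ∀ k {T} → T ⊆ triangle k → degree 0F T ≡ 2 → degree 1F T ≡ 2 → T ≡ triangle k
  triangle-forced k (refl ∷ refl ∷ refl ∷ [])       _  _  = refl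
  triangle-forced k (refl ∷ refl ∷ (_ ∷ʳ []))       _  ()
  triangle-forced k (refl ∷ (_ ∷ʳ refl ∷ []))       () _
  triangle-forced k (refl ∷ (_ ∷ʳ (_ ∷ʳ [])))       () _
  triangle-forced k (_ ∷ʳ refl ∷ refl ∷ [])         () _
  triangle-forced k (_ ∷ʳ refl ∷ (_ ∷ʳ []))         () _
  triangle-forced k (_ ∷ʳ (_ ∷ʳ refl ∷ []))         () _
  triangle-forced k (_ ∷ʳ (_ ∷ʳ (_ ∷ʳ [])))         () _

  peel-triangle : ∀ k {E} → E ⊆ edges (W (suc k)) → degree 0F E ≡ 2 → degree 1F E ≡ 2 →
    Σ (List (Edge (order k))) λ E′ → E′ ⊆ edges (W k) × E ≡ triangle k ++ map shift E′
  peel-triangle k {E} E⊆ deg0 deg1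
    with ⊆-++-split (triangle k) (subst (E ⊆_) (windmill-edges k) E⊆)
  ... | T , S , T⊆ , S⊆ , refl with ⊆-map-split shift S⊆
  ... | E′ , E′⊆ , refl =
    E′ , E′⊆ , cong (_++ map shift E′)
      (triangle-forced k T⊆ (on-triangle 0F (degree-0F-shift E′) deg0)
                            (on-triangle 1F (degree-1F-shift E′) deg1))
    where
    on-triangle : ∀ v → degree v (map shift E′) ≡ 0 → degree v (T ++ map shift E′) ≡ 2 →
                  degree v T ≡ 2
    on-triangle v untouched deg = begin
        degree v T                             ≡⟨ +-identityʳ (degree v T) ⟨
        degree v T + 0                         ≡⟨ cong (degree v T +_) untouched ⟨
        degree v T + degree v (map shift E′)   ≡⟨ countᵇ-++ _ T (map shift E′) ⟨
        degree v (T ++ map shift E′)           ≡⟨ deg ⟩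
        2                                      ∎
      where open ≡-Reasoning

  hub-degree : ∀ k {E} → E ⊆ edges (W k) → (∀ u → isHub k u ≡ false → degree u E ≡ 2) →
    degree (hub k) E ≡ 2 * k
  hub-degree zero    []  _    = refl
  hub-degree (suc k) E⊆ deg₂ with peel-triangle k E⊆ (deg₂ 0F refl) (deg₂ 1F refl)
  ... | E′ , E′⊆ , refl = begin
      degree (old (hub k)) (triangle k ++ map shift E′) ≡⟨ degree-hub-attached k E′ ⟩
      2 + degree (hub k) E′                             ≡⟨ cong (2 +_) (hub-degree k E′⊆ deg₂′) ⟩
      2 + 2 * k                                         ≡⟨ *-suc 2 k ⟨
      2 * suc k                                         ∎
    where
    open ≡-Reasoning
    deg₂′ : ∀ u → isHub k u ≡ false → degree u E′ ≡ 2
    deg₂′ u notHub = trans (sym (degree-other-attached k E′ notHub)) (deg₂ (old u) notHub)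

  triangle-covers : vdccCount (W 1) ≡ 1
  triangle-covers = refl

  -- A windmill with at least two triangles has no cycle cover: its hub would have degree ≥ 4.
  windmill-no-cover : ∀ k → vdccCount (W (suc (suc k))) ≡ 0
  windmill-no-cover k = count-sublists-zero (edges G) (isVDCC G) rejected
    where
    G = W (suc (suc k))
    rejected : ∀ E → E ⊆ edges G → isVDCC G E ≡ false
    rejected E E⊆ with isVDCC G E in accepted
    ... | false = refl
    ... | true  = ⊥-elim (hub-not-two (trans (sym hub-twice) (all-two (hub (suc (suc k))))))
      where
      all-two = isVDCC-sound G E accepted
      hub-twice = hub-degree (suc (suc k)) E⊆ (λ u _ → all-two u)
      -- 2 · (k+2) = 2 + (k + (k+2)) with k + (k+2) ≠ 0
      hub-not-two : 2 * suc (suc k) ≢ 2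
      hub-not-two eq = m+1+n≢0 k (suc-injective (suc-injective eq))

module FiniteSums {c ℓ} (F : Field c ℓ) where
  open import Data.Fin using (Fin)
  open import Data.Nat using (zero; suc)
  open import Function using (_∘_)
  import Relation.Binary.PropositionalEquality as ≡
  open Field F
  open import Algebra.Properties.CommutativeMonoid.Sum +-commutativeMonoid
    using (sum; sum-cong-≋; ∑-distrib-+; ∑-comm)
  open import Algebra.Properties.Semiring.Sum semiring using (*-distribˡ-sum)
  open import Relation.Binary.Reasoning.Setoid setoid

  -- `sumFin` is the library's sum of a functional vector; the lemmas below are
  -- transported from there.
  sumFin≡sum : ∀ k (f : Fin k → Carrier) → sumFin F k f ≡.≡ sum f
  sumFin≡sum zero    f = ≡.refl
  sumFin≡sum (suc k) f = ≡.cong (f Fin.zero +_) (sumFin≡sum k (f ∘ Fin.suc))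

  sumFin-cong : ∀ k {f g : Fin k → Carrier} → (∀ i → f i ≈ g i) → sumFin F k f ≈ sumFin F k g
  sumFin-cong k {f} {g} f≈g = begin
    sumFin F k f  ≡⟨ sumFin≡sum k f ⟩
    sum f         ≈⟨ sum-cong-≋ f≈g ⟩
    sum g         ≡⟨ sumFin≡sum k g ⟨
    sumFin F k g  ∎

  sumFin-+ : ∀ k (f g : Fin k → Carrier) →
    sumFin F k (λ i → f i + g i) ≈ sumFin F k f + sumFin F k g
  sumFin-+ k f g = begin
    sumFin F k (λ i → f i + g i)  ≡⟨ sumFin≡sum k _ ⟩
    sum (λ i → f i + g i)         ≈⟨ ∑-distrib-+ f g ⟩
    sum f + sum g                 ≡⟨ ≡.cong₂ _+_ (sumFin≡sum k f) (sumFin≡sum k g) ⟨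
    sumFin F k f + sumFin F k g   ∎

  sumFin-*ˡ : ∀ k x (f : Fin k → Carrier) → sumFin F k (λ i → x * f i) ≈ x * sumFin F k f
  sumFin-*ˡ k x f = begin
    sumFin F k (λ i → x * f i)  ≡⟨ sumFin≡sum k _ ⟩
    sum (λ i → x * f i)         ≈⟨ *-distribˡ-sum x f ⟨
    x * sum f                   ≡⟨ ≡.cong (x *_) (sumFin≡sum k f) ⟨
    x * sumFin F k f            ∎

  sumFin-*ʳ : ∀ k x (f : Fin k → Carrier) → sumFin F k (λ i → f i * x) ≈ sumFin F k f * x
  sumFin-*ʳ k x f = begin
    sumFin F k (λ i → f i * x)  ≈⟨ sumFin-cong k (λ i → *-comm (f i) x) ⟩
    sumFin F k (λ i → x * f i)  ≈⟨ sumFin-*ˡ k x f ⟩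
    x * sumFin F k f            ≈⟨ *-comm x _ ⟩
    sumFin F k f * x            ∎

  sumFin-comm : ∀ k m (f : Fin k → Fin m → Carrier) →
    sumFin F k (λ i → sumFin F m (f i)) ≈ sumFin F m (λ j → sumFin F k (λ i → f i j))
  sumFin-comm k m f = begin
    sumFin F k (λ i → sumFin F m (f i))
      ≈⟨ sumFin-cong k (λ i → reflexive (sumFin≡sum m (f i))) ⟩
    sumFin F k (λ i → sum (f i))
      ≡⟨ sumFin≡sum k _ ⟩
    sum (λ i → sum (f i))
      ≈⟨ ∑-comm f ⟩
    sum (λ j → sum (λ i → f i j))
      ≡⟨ sumFin≡sum m _ ⟨
    sumFin F m (λ j → sum (λ i → f i j))
      ≈⟨ sumFin-cong m (λ j → reflexive (sumFin≡sum k (λ i → f i j))) ⟨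
    sumFin F m (λ j → sumFin F k (λ i → f i j))
      ∎

  sumMaps-cong : ∀ n q {f g : (Fin n → Fin q) → Carrier} → (∀ φ → f φ ≈ g φ) →
    sumMaps F n q f ≈ sumMaps F n q g
  sumMaps-cong zero    q f≈g = f≈g _
  sumMaps-cong (suc n) q f≈g = sumFin-cong q (λ a → sumMaps-cong n q (λ φ → f≈g _))

  sumFin-sumMaps : ∀ k n q (f : Fin k → (Fin n → Fin q) → Carrier) →
    sumFin F k (λ b → sumMaps F n q (f b)) ≈ sumMaps F n q (λ ψ → sumFin F k (λ b → f b ψ))
  sumFin-sumMaps k zero    q f = refl
  sumFin-sumMaps k (suc n) q f =
    trans (sumFin-comm k q _) (sumFin-cong q (λ a → sumFin-sumMaps k n q _))

module PowerSums {c ℓ} (F : Field c ℓ) where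
  open import Algebra.Bundles using (Semiring)
  open import Data.Fin using (Fin)
  open import Data.Maybe using (nothing)
  open import Data.Nat using (ℕ; zero; suc)
  open import Data.Product using (proj₁; proj₂)
  open import Function using (_∘_)
  open Field F
  open FiniteSums F
  open import Algebra.Definitions.RawSemiring (Semiring.rawSemiring semiring) public using (_^_)
  open import Algebra.Properties.Ring ring using (-‿involutive; -0#≈0#)
  open import Algebra.Solver.Ring.NaturalCoefficients commutativeSemiring (λ _ _ → nothing)
    using (solve; _:=_; _:+_; _:*_)
  open import Relation.Binary.Reasoning.Setoid setoid

  powerSum : ∀ q → (Fin q → Carrier) → (Fin q → Carrier) → ℕ → Carrier
  powerSum q a w j = sumFin F q (λ i → a i * w i ^ j)

  cancel-nonzero : ∀ {x y} → x * y ≈ 0# → ¬ (y ≈ 0#) → x ≈ 0#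
  cancel-nonzero {x} {y} xy≈0 y≉0 = begin
    x              ≈⟨ *-identityʳ x ⟨
    x * 1#         ≈⟨ *-cong refl (proj₂ (inverse y y≉0)) ⟨
    x * (y * y⁻¹)  ≈⟨ *-assoc x y y⁻¹ ⟨
    (x * y) * y⁻¹  ≈⟨ *-cong xy≈0 refl ⟩
    0# * y⁻¹       ≈⟨ zeroˡ y⁻¹ ⟩
    0#             ∎
    where y⁻¹ = proj₁ (inverse y y≉0)

  deflated : ∀ {q} → (Fin (suc q) → Carrier) → (Fin (suc q) → Carrier) → Fin q → Carrier
  deflated a w i = a (Fin.suc i) * (w (Fin.suc i) + - w Fin.zero)

  deflate : ∀ q (a w : Fin (suc q) → Carrier) j →
    powerSum q (deflated a w) (w ∘ Fin.suc) j ≈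
    powerSum (suc q) a w (suc j) + - w Fin.zero * powerSum (suc q) a w j
  deflate q a w j = begin
    powerSum q (deflated a w) (w ∘ Fin.suc) j
      ≈⟨ sumFin-cong q (λ i → expand (a (Fin.suc i)) (w (Fin.suc i)) d (w (Fin.suc i) ^ j)) ⟩
    sumFin F q (λ i → a (Fin.suc i) * w (Fin.suc i) ^ suc j + d * (a (Fin.suc i) * w (Fin.suc i) ^ j))
      ≈⟨ sumFin-+ q _ _ ⟩
    M′ (suc j) + sumFin F q (λ i → d * (a (Fin.suc i) * w (Fin.suc i) ^ j))
      ≈⟨ +-cong refl (sumFin-*ˡ q d _) ⟩
    M′ (suc j) + d * M′ j
      ≈⟨ +-identityˡ _ ⟨
    0# + (M′ (suc j) + d * M′ j)
      ≈⟨ +-cong (trans (*-cong refl (-‿inverseʳ c₀)) (zeroʳ _)) refl ⟨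
    (a₀ * c₀ ^ j) * (c₀ + d) + (M′ (suc j) + d * M′ j)
      ≈⟨ regroup a₀ c₀ (c₀ ^ j) (M′ (suc j)) d (M′ j) ⟨
    powerSum (suc q) a w (suc j) + d * powerSum (suc q) a w j
      ∎
    where
    a₀ = a Fin.zero
    c₀ = w Fin.zero
    d  = - c₀
    M′ = powerSum q (a ∘ Fin.suc) (w ∘ Fin.suc)
    expand : ∀ x y z p → (x * (y + z)) * p ≈ x * (y * p) + z * (x * p)
    expand = solve 4 (λ x y z p → (x :* (y :+ z)) :* p := x :* (y :* p) :+ z :* (x :* p)) refl
    regroup : ∀ x y p m z m′ → (x * (y * p) + m) + z * (x * p + m′) ≈ (x * p) * (y + z) + (m + z * m′)
    regroup = solve 6 (λ x y p m z m′ →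
      (x :* (y :* p) :+ m) :+ z :* (x :* p :+ m′) := (x :* p) :* (y :+ z) :+ (m :+ z :* m′)) refl

  drop-zero-node : ∀ q (a w : Fin (suc q) → Carrier) → w Fin.zero ≈ 0# → ∀ j →
    powerSum (suc q) a w (suc j) ≈ powerSum q (a ∘ Fin.suc) (w ∘ Fin.suc) (suc j)
  drop-zero-node q a w c₀≈0 j = begin
    a₀ * (c₀ * c₀ ^ j) + M′       ≈⟨ +-cong (*-cong refl (*-cong c₀≈0 refl)) refl ⟩
    a₀ * (0# * c₀ ^ j) + M′       ≈⟨ +-cong (trans (*-cong refl (zeroˡ _)) (zeroʳ a₀)) refl ⟩
    0# + M′                       ≈⟨ +-identityˡ M′ ⟩
    M′                            ∎
    where
    a₀ = a Fin.zero
    c₀ = w Fin.zero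
    M′ = powerSum q (a ∘ Fin.suc) (w ∘ Fin.suc) (suc j)

  -- Induction on the number of nodes: deflate node 0; if the deflated first power sum
  -- vanished, node 0 would be 0 and could be dropped instead.
  powerSum-vanishing : ∀ q (a w : Fin q → Carrier) →
    (∀ k → powerSum q a w (suc (suc k)) ≈ 0#) → ¬ ¬ (powerSum q a w 1 ≈ 0#)
  powerSum-vanishing zero    a w vanish M₁≉0 = M₁≉0 refl
  powerSum-vanishing (suc q) a w vanish M₁≉0 =
    powerSum-vanishing q (deflated a w) (w ∘ Fin.suc) deflated-vanish deflated-nonzero
    where
    M = powerSum (suc q) a w
    c₀ = w Fin.zero

    deflated-vanish : ∀ k → powerSum q (deflated a w) (w ∘ Fin.suc) (suc (suc k)) ≈ 0#
    deflated-vanish k = begin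
      powerSum q (deflated a w) (w ∘ Fin.suc) (suc (suc k))
        ≈⟨ deflate q a w (suc (suc k)) ⟩
      M (suc (suc (suc k))) + - c₀ * M (suc (suc k))
        ≈⟨ +-cong (vanish (suc k)) (*-cong refl (vanish k)) ⟩
      0# + - c₀ * 0#
        ≈⟨ trans (+-identityˡ _) (zeroʳ _) ⟩
      0#
        ∎

    deflated-nonzero : ¬ (powerSum q (deflated a w) (w ∘ Fin.suc) 1 ≈ 0#)
    deflated-nonzero deflated₁≈0 =
      powerSum-vanishing q (a ∘ Fin.suc) (w ∘ Fin.suc) tail-vanish tail-nonzero
      where
      -c₀M₁≈0 : - c₀ * M 1 ≈ 0#
      -c₀M₁≈0 = begin
        - c₀ * M 1                                    ≈⟨ +-identityˡ _ ⟨
        0# + - c₀ * M 1                               ≈⟨ +-cong (vanish 0) refl ⟨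
        M 2 + - c₀ * M 1                              ≈⟨ deflate q a w 1 ⟨
        powerSum q (deflated a w) (w ∘ Fin.suc) 1     ≈⟨ deflated₁≈0 ⟩
        0#                                            ∎
      c₀≈0 : c₀ ≈ 0#
      c₀≈0 = begin
        c₀      ≈⟨ -‿involutive c₀ ⟨
        - - c₀  ≈⟨ -‿cong (cancel-nonzero -c₀M₁≈0 M₁≉0) ⟩
        - 0#    ≈⟨ -0#≈0# ⟩
        0#      ∎
      tail-vanish : ∀ k → powerSum q (a ∘ Fin.suc) (w ∘ Fin.suc) (suc (suc k)) ≈ 0#
      tail-vanish k = trans (sym (drop-zero-node q a w c₀≈0 (suc k))) (vanish k)
      tail-nonzero : ¬ (powerSum q (a ∘ Fin.suc) (w ∘ Fin.suc) 1 ≈ 0#)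
      tail-nonzero tail₁≈0 = M₁≉0 (trans (drop-zero-node q a w c₀≈0 0) tail₁≈0)

module WindmillHom {c ℓ} (F : Field c ℓ) (H : WeightedGraph F) where
  open import Data.Fin using (Fin)
  open import Data.List using (List; []; _∷_; map; foldr)
  open import Data.Maybe using (nothing)
  open import Data.Nat using (zero; suc)
  open import Function using (_∘_)
  import Relation.Binary.PropositionalEquality as ≡
  open Windmills using (order; hub; W; Edge; shift; windmill-edges; 0F; 1F; old)
  open Field F
  open WeightedGraph H
  open FiniteSums F
  open PowerSums F
  open import Algebra.Solver.Ring.NaturalCoefficients commutativeSemiring (λ _ _ → nothing)
    using (solve; _:=_; _:*_)
  open import Relation.Binary.Reasoning.Setoid setoid

  edgeWeight : ∀ {m} → (Fin m → Fin q) → List (Edge m) → Carrier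
  edgeWeight φ []            = 1#
  edgeWeight φ ((u , v) ∷ L) = β (φ u) (φ v) * edgeWeight φ L

  foldr-edgeWeight : ∀ {m} (φ : Fin m → Fin q) {g : Edge m → Carrier → Carrier} L →
    (∀ u v acc → g (u , v) acc ≡.≡ β (φ u) (φ v) * acc) → foldr g 1# L ≡.≡ edgeWeight φ L
  foldr-edgeWeight φ []            g≗ = ≡.refl
  foldr-edgeWeight φ ((u , v) ∷ L) g≗ =
    ≡.trans (g≗ u v _) (≡.cong (β (φ u) (φ v) *_) (foldr-edgeWeight φ L g≗))

  edgeWeight-shift : ∀ {m} (φ : Fin (suc (suc m)) → Fin q) L →
    edgeWeight φ (map shift L) ≡.≡ edgeWeight (φ ∘ Fin.suc ∘ Fin.suc) L
  edgeWeight-shift φ []            = ≡.refl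
  edgeWeight-shift φ ((u , v) ∷ L) = ≡.cong (β (φ (old u)) (φ (old v)) *_) (edgeWeight-shift φ L)

  mapWeight : ∀ k → (Fin (order k) → Fin q) → Carrier
  mapWeight k φ = prodFin F (order k) (α ∘ φ) * edgeWeight φ (edges (W k))

  hom-windmill-maps : ∀ k → hom F (W k) H ≈ sumMaps F (order k) q (mapWeight k)
  hom-windmill-maps k = sumMaps-cong (order k) q (λ φ →
    *-cong refl (reflexive (foldr-edgeWeight φ (edges (W k)) (λ _ _ _ → ≡.refl))))

  bladeWeight : Fin q → Fin q → Fin q → Carrier
  bladeWeight b c a = α b * (α c * (β b c * (β b a * β c a)))

  triangleWeight : Fin q → Carrier
  triangleWeight a = sumFin F q (λ b → sumFin F q (λ c → bladeWeight b c a))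

  mapWeight-peel : ∀ k (φ : Fin (order (suc k)) → Fin q) →
    mapWeight (suc k) φ ≈
    bladeWeight (φ 0F) (φ 1F) (φ (hub (suc k))) * mapWeight k (φ ∘ Fin.suc ∘ Fin.suc)
  mapWeight-peel k φ = trans (*-cong refl (reflexive edges-peeled)) (regroup _ _ _ _ _ _ _)
    where
    ψ = φ ∘ Fin.suc ∘ Fin.suc
    h = φ (hub (suc k))
    edges-peeled : edgeWeight φ (edges (W (suc k))) ≡.≡
      β (φ 0F) (φ 1F) * (β (φ 0F) h * (β (φ 1F) h * edgeWeight ψ (edges (W k))))
    edges-peeled = ≡.trans (≡.cong (edgeWeight φ) (windmill-edges k))
      (≡.cong (λ rest → β (φ 0F) (φ 1F) * (β (φ 0F) h * (β (φ 1F) h * rest)))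
              (edgeWeight-shift φ (edges (W k))))
    regroup : ∀ αb αc P βbc βba βca E →
      (αb * (αc * P)) * (βbc * (βba * (βca * E))) ≈ (αb * (αc * (βbc * (βba * βca)))) * (P * E)
    regroup = solve 7 (λ αb αc P βbc βba βca E →
      (αb :* (αc :* P)) :* (βbc :* (βba :* (βca :* E)))
        := (αb :* (αc :* (βbc :* (βba :* βca)))) :* (P :* E)) refl

  -- Sum over all maps of W k, weighted by a function g of the image of the hub:
  -- each triangle multiplies the hub's contribution by its triangle weight.
  hub-weighted-sum : ∀ k (g : Fin q → Carrier) →
    sumMaps F (order k) q (λ φ → g (φ (hub k)) * mapWeight k φ) ≈
    powerSum q (λ a → α a * g a) triangleWeight k
  hub-weighted-sum zero    g = sumFin-cong q (λ a → begin
    g a * ((α a * 1#) * 1#)  ≈⟨ *-cong refl (trans (*-identityʳ _) (*-identityʳ _)) ⟩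
    g a * α a                ≈⟨ *-comm (g a) (α a) ⟩
    α a * g a                ≈⟨ *-identityʳ _ ⟨
    (α a * g a) * 1#         ∎)
  hub-weighted-sum (suc k) g = begin
    sumMaps F (order (suc k)) q (λ φ → g (φ (hub (suc k))) * mapWeight (suc k) φ)
      ≈⟨ sumMaps-cong (order (suc k)) q peel ⟩
    sumFin F q (λ b → sumFin F q (λ c → sumMaps F (order k) q (λ ψ → bladeWeight b c (ψ h) * G ψ)))
      ≈⟨ sumFin-cong q (λ b → sumFin-sumMaps q (order k) q (λ c ψ → bladeWeight b c (ψ h) * G ψ)) ⟩
    sumFin F q (λ b → sumMaps F (order k) q (λ ψ → sumFin F q (λ c → bladeWeight b c (ψ h) * G ψ)))
      ≈⟨ sumFin-sumMaps q (order k) q (λ b ψ → sumFin F q (λ c → bladeWeight b c (ψ h) * G ψ)) ⟩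
    sumMaps F (order k) q (λ ψ → sumFin F q (λ b → sumFin F q (λ c → bladeWeight b c (ψ h) * G ψ)))
      ≈⟨ sumMaps-cong (order k) q (λ ψ → sum-blades (ψ h) (G ψ)) ⟩
    sumMaps F (order k) q (λ ψ → triangleWeight (ψ h) * G ψ)
      ≈⟨ sumMaps-cong (order k) q (λ ψ → sym (*-assoc _ _ _)) ⟩
    sumMaps F (order k) q (λ ψ → (triangleWeight (ψ h) * g (ψ h)) * mapWeight k ψ)
      ≈⟨ hub-weighted-sum k (λ a → triangleWeight a * g a) ⟩
    powerSum q (λ a → α a * (triangleWeight a * g a)) triangleWeight k
      ≈⟨ sumFin-cong q (λ a → absorb-factor (α a) (triangleWeight a) (g a) (triangleWeight a ^ k)) ⟩
    powerSum q (λ a → α a * g a) triangleWeight (suc k)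
      ∎
    where
    h = hub k
    G : (Fin (order k) → Fin q) → Carrier
    G ψ = g (ψ h) * mapWeight k ψ
    peel : ∀ φ → g (φ (hub (suc k))) * mapWeight (suc k) φ ≈
                 bladeWeight (φ 0F) (φ 1F) (φ (hub (suc k))) * G (φ ∘ Fin.suc ∘ Fin.suc)
    peel φ = trans (*-cong refl (mapWeight-peel k φ))
                   (x[yz]≈y[xz] (g (φ (hub (suc k)))) (bladeWeight (φ 0F) (φ 1F) (φ (hub (suc k))))
                                (mapWeight k (φ ∘ Fin.suc ∘ Fin.suc)))
      where
      x[yz]≈y[xz] : ∀ x y z → x * (y * z) ≈ y * (x * z)
      x[yz]≈y[xz] = solve 3 (λ x y z → x :* (y :* z) := y :* (x :* z)) refl
    absorb-factor : ∀ x t y p → (x * (t * y)) * p ≈ (x * y) * (t * p)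
    absorb-factor = solve 4 (λ x t y p → (x :* (t :* y)) :* p := (x :* y) :* (t :* p)) refl
    sum-blades : ∀ a R →
      sumFin F q (λ b → sumFin F q (λ c → bladeWeight b c a * R)) ≈ triangleWeight a * R
    sum-blades a R = trans (sumFin-cong q (λ b → sumFin-*ʳ q R (λ c → bladeWeight b c a)))
                           (sumFin-*ʳ q R (λ b → sumFin F q (λ c → bladeWeight b c a)))

  hom-windmill : ∀ k → hom F (W k) H ≈ powerSum q α triangleWeight k
  hom-windmill k = begin
    hom F (W k) H
      ≈⟨ hom-windmill-maps k ⟩
    sumMaps F (order k) q (mapWeight k)
      ≈⟨ sumMaps-cong (order k) q (λ φ → *-identityˡ _) ⟨
    sumMaps F (order k) q (λ φ → 1# * mapWeight k φ)
      ≈⟨ hub-weighted-sum k (λ _ → 1#) ⟩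
    powerSum q (λ a → α a * 1#) triangleWeight k
      ≈⟨ sumFin-cong q (λ a → *-cong (*-identityʳ (α a)) refl) ⟩
    powerSum q α triangleWeight k
      ∎

theorem4p7 : ∀ {c ℓ} (F : Field c ℓ) →
    ¬ Σ (WeightedGraph F) (λ H → ∀ (G : SimpleGraph) → Field._≈_ F (vdcc F G) (hom F G H))
theorem4p7 F (H , vdcc≈hom) =
  powerSum-vanishing q α triangleWeight large-windmills-vanish triangle-nonzero
  where
  open import Data.Nat using (suc)
  import Relation.Binary.PropositionalEquality as ≡
  open Field F
  open WeightedGraph H
  open PowerSums F
  open WindmillHom F H
  open Windmills using (W; triangle-covers; windmill-no-cover)
  open import Relation.Binary.Reasoning.Setoid setoid

  large-windmills-vanish : ∀ k → powerSum q α triangleWeight (suc (suc k)) ≈ 0#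
  large-windmills-vanish k = begin
    powerSum q α triangleWeight (suc (suc k))  ≈⟨ hom-windmill (suc (suc k)) ⟨
    hom F (W (suc (suc k))) H                  ≈⟨ vdcc≈hom (W (suc (suc k))) ⟨
    natF F (vdccCount (W (suc (suc k))))       ≡⟨ ≡.cong (natF F) (windmill-no-cover k) ⟩
    0#                                         ∎

  triangle-nonzero : ¬ (powerSum q α triangleWeight 1 ≈ 0#)
  triangle-nonzero M₁≈0 = 1≉0 (begin
    1#                             ≈⟨ +-identityʳ 1# ⟨
    natF F 1                       ≡⟨ ≡.cong (natF F) triangle-covers ⟨
    natF F (vdccCount (W 1))       ≈⟨ vdcc≈hom (W 1) ⟩
    hom F (W 1) H                  ≈⟨ hom-windmill 1 ⟩
    powerSum q α triangleWeight 1  ≈⟨ M₁≈0 ⟩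
    0#                             ∎)
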